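{- For every integer $r\geq 2$, \[ w_r(3)=(3-e_r)\,r!-1. \]
   Context: For each integer $r\geq 2$, $w_r:\mathbb{Z}_{\geq 2}^r\to\mathbb{Z}_{\geq 0}$ denotes the family of functions uniquely determined by: (i) $w_2(k_1,k_2)=0$ for $k_1,k_2\geq 2$; (ii) for $r\geq 2$ and $k_1,\dots,k_r\geq 2$, inserting a coordinate equal to $2$ at any position of $(k_1,\dots,k_r)$ gives an $(r+1)$-tuple at which $w_{r+1}$ equals $w_r(k_1,\dots,k_r)$; (iii) for $k_1,\dots,k_r\geq 3$, $w_r(k_1,\dots,k_r)=\sum_{i=1}^r w_r(k_1,\dots,k_i-1,\dots,k_r)+(r-2)$ (the $i$-th coordinate decreased by $1$). $w_r(3)$ means $w_r(3,\dots,3)$, and $e_r=\sum_{n=0}^r\frac{1}{n!}$. -}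

module Defs where

open import Data.Nat as ℕ using (ℕ; zero; suc; _≤_; _∸_; _+_; _!)
open import Data.Nat.Properties using (_!≢0)

open import Data.Fin using (Fin)
open import Data.Vec using (Vec; []; _∷_; insertAt; replicate; updateAt; tabulate)
open import Data.Vec.Relation.Unary.All using (All)
open import Data.Integer using (+_)
open import Data.Rational as ℚ using (ℚ; _/_)
open import Data.List using (List; upTo; map; foldr)
open import Relation.Binary.PropositionalEquality using (_≡_)

-- a family of functions w_r : ℕ^r → ℕ, indexed by r (only r ≥ 2 and
-- tuples with all entries ≥ 2 are constrained)
Family : Set
Family = (r : ℕ) → Vec ℕ r → ℕ

vsum : ∀ {n} → Vec ℕ n → ℕ
vsum = Data.Vec.foldr _ _+_ 0

Cond-i : Family → Set
Cond-i w = ∀ k₁ k₂ → 2 ≤ k₁ → 2 ≤ k₂ → w 2 (k₁ ∷ k₂ ∷ []) ≡ 0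

Cond-ii : Family → Set
Cond-ii w = ∀ r → 2 ≤ r → (k : Vec ℕ r) → All (2 ≤_) k →
  (i : Fin (suc r)) → w (suc r) (insertAt k i 2) ≡ w r k

Cond-iii : Family → Set
Cond-iii w = ∀ r → 2 ≤ r → (k : Vec ℕ r) → All (3 ≤_) k →
  w r k ≡ vsum (tabulate (λ i → w r (updateAt k i ℕ.pred))) + (r ∸ 2)

IsW : Family → Set
IsW w = Cond-i w × Cond-ii w × Cond-iii w
  where open import Data.Product using (_×_)

w3 : Family → ℕ → ℕ
w3 w r = w r (replicate r 3)

inv! : ℕ → ℚ
inv! n = _/_ (+ 1) (n !) {{n !≢0}}

e : ℕ → ℚ
e r = foldr ℚ._+_ ℚ.0ℚ (map inv! (upTo (suc r)))

toℚ : ℕ → ℚ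
toℚ n = (+ n) / 1

-- Applying (iii) to (3,…,3) lowers one coordinate to 2, which (ii) then deletes, so
-- w_{r+1}(3) = (r+1) w_r(3) + (r-1), with w_2(3) = 0 by (i). The closed form obeys the
-- same recurrence because e_{r+1} (r+1)! = e_r (r+1)! + 1.
module Submission where

open import Defs
open import Data.Nat using (ℕ; _≤_; _!)
open import Data.Nat.Properties using (_!≢0)

open import Data.Rational using (_-_; _*_)
open import Relation.Binary.PropositionalEquality using (_≡_)

open import Data.Nat as ℕ using (zero; suc; s≤s; z≤n; NonZero)
open import Data.Fin using (Fin) renaming (zero to fzero; suc to fsuc)
open import Data.Vec using (Vec; _∷_; insertAt; replicate; updateAt; tabulate) renaming ([] to []ᵥ)
open import Data.Vec.Relation.Unary.All using (All; []; _∷_)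
open import Data.Product using (_,_)
open import Data.Integer as ℤ using (+_)
import Data.Integer.Properties as ℤ
open import Data.Rational as ℚ using (ℚ; 1ℚ; 0ℚ; _+_; fromℚᵘ; toℚᵘ)
import Data.Rational.Properties as ℚ
open import Data.Rational.Unnormalised as ℚᵘ using (ℚᵘ; mkℚᵘ; *≡*)
import Data.Rational.Unnormalised.Properties as ℚᵘ
open import Data.Rational.Solver using (module +-*-Solver)
import Data.Nat.Coprimality as C
open import Data.List as List using (List; _∷ʳ_)
import Data.List.Properties as List
open import Relation.Binary.PropositionalEquality
  using (refl; sym; trans; cong; cong₂; module ≡-Reasoning)

open ≡-Reasoning

All-replicate : ∀ {A : Set} {P : A → Set} {x} n → P x → All P (replicate n x)
All-replicate zero    px = []
All-replicate (suc n) px = px ∷ All-replicate n px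

updateAt-replicate : ∀ {A : Set} n (x : A) (i : Fin (suc n)) (f : A → A) →
  updateAt (replicate (suc n) x) i f ≡ insertAt (replicate n x) i (f x)
updateAt-replicate n       x fzero    f = refl
updateAt-replicate (suc n) x (fsuc i) f = cong (x ∷_) (updateAt-replicate n x i f)

vsum-tabulate-const : ∀ n {f : Fin n → ℕ} {c} → (∀ i → f i ≡ c) →
  vsum (tabulate f) ≡ n ℕ.* c
vsum-tabulate-const zero    f≡c = refl
vsum-tabulate-const (suc n) f≡c =
  cong₂ ℕ._+_ (f≡c fzero) (vsum-tabulate-const n (λ i → f≡c (fsuc i)))

w3-two : ∀ {w} → IsW w → w3 w 2 ≡ 0
w3-two {w} (cond-i , _ , cond-iii) = begin
  w3 w 2
    ≡⟨ cond-iii 2 2≤2 (replicate 2 3) (All-replicate 2 3≤3) ⟩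
  w 2 (2 ∷ 3 ∷ []ᵥ) ℕ.+ (w 2 (3 ∷ 2 ∷ []ᵥ) ℕ.+ 0) ℕ.+ 0
    ≡⟨ cong₂ (λ u v → u ℕ.+ (v ℕ.+ 0) ℕ.+ 0) (cond-i 2 3 2≤2 2≤3) (cond-i 3 2 2≤3 2≤2) ⟩
  0 ∎
  where
  2≤2 : 2 ≤ 2
  2≤2 = s≤s (s≤s z≤n)
  2≤3 : 2 ≤ 3
  2≤3 = s≤s (s≤s z≤n)
  3≤3 : 3 ≤ 3
  3≤3 = s≤s 2≤2

w3-suc : ∀ {w} → IsW w → ∀ n → w3 w (3 ℕ.+ n) ≡ (3 ℕ.+ n) ℕ.* w3 w (2 ℕ.+ n) ℕ.+ suc n
w3-suc {w} (_ , cond-ii , cond-iii) n = begin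
  w3 w (3 ℕ.+ n)
    ≡⟨ cond-iii (3 ℕ.+ n) 2≤r (replicate (3 ℕ.+ n) 3) (All-replicate (3 ℕ.+ n) 3≤3) ⟩
  vsum (tabulate (λ i → w (3 ℕ.+ n) (lowerAt i))) ℕ.+ suc n
    ≡⟨ cong (ℕ._+ suc n) (vsum-tabulate-const (3 ℕ.+ n) w-lowerAt) ⟩
  (3 ℕ.+ n) ℕ.* w3 w (2 ℕ.+ n) ℕ.+ suc n ∎
  where
  2≤r : ∀ {m} → 2 ≤ 2 ℕ.+ m
  2≤r = s≤s (s≤s z≤n)
  3≤3 : 3 ≤ 3
  3≤3 = s≤s 2≤r
  lowerAt : Fin (3 ℕ.+ n) → Vec ℕ (3 ℕ.+ n)
  lowerAt i = updateAt (replicate (3 ℕ.+ n) 3) i ℕ.pred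
  w-lowerAt : ∀ i → w (3 ℕ.+ n) (lowerAt i) ≡ w3 w (2 ℕ.+ n)
  w-lowerAt i = begin
    w (3 ℕ.+ n) (lowerAt i)
      ≡⟨ cong (w (3 ℕ.+ n)) (updateAt-replicate (2 ℕ.+ n) 3 i ℕ.pred) ⟩
    w (3 ℕ.+ n) (insertAt (replicate (2 ℕ.+ n) 3) i 2)
      ≡⟨ cond-ii (2 ℕ.+ n) 2≤r (replicate (2 ℕ.+ n) 3) (All-replicate (2 ℕ.+ n) 2≤r) i ⟩
    w3 w (2 ℕ.+ n) ∎

fromℚᵘ-homo-+ : ∀ p q → fromℚᵘ (p ℚᵘ.+ q) ≡ fromℚᵘ p + fromℚᵘ q
fromℚᵘ-homo-+ p q = begin
  fromℚᵘ (p ℚᵘ.+ q)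
    ≡⟨ ℚ.fromℚᵘ-cong (ℚᵘ.+-cong (ℚᵘ.≃-sym (ℚ.toℚᵘ-fromℚᵘ p)) (ℚᵘ.≃-sym (ℚ.toℚᵘ-fromℚᵘ q))) ⟩
  fromℚᵘ (toℚᵘ (fromℚᵘ p) ℚᵘ.+ toℚᵘ (fromℚᵘ q))
    ≡⟨ ℚ.fromℚᵘ-cong (ℚᵘ.≃-sym (ℚ.toℚᵘ-homo-+ (fromℚᵘ p) (fromℚᵘ q))) ⟩
  fromℚᵘ (toℚᵘ (fromℚᵘ p + fromℚᵘ q))
    ≡⟨ ℚ.fromℚᵘ-toℚᵘ (fromℚᵘ p + fromℚᵘ q) ⟩
  fromℚᵘ p + fromℚᵘ q ∎

fromℚᵘ-homo-* : ∀ p q → fromℚᵘ (p ℚᵘ.* q) ≡ fromℚᵘ p * fromℚᵘ q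
fromℚᵘ-homo-* p q = begin
  fromℚᵘ (p ℚᵘ.* q)
    ≡⟨ ℚ.fromℚᵘ-cong (ℚᵘ.*-cong (ℚᵘ.≃-sym (ℚ.toℚᵘ-fromℚᵘ p)) (ℚᵘ.≃-sym (ℚ.toℚᵘ-fromℚᵘ q))) ⟩
  fromℚᵘ (toℚᵘ (fromℚᵘ p) ℚᵘ.* toℚᵘ (fromℚᵘ q))
    ≡⟨ ℚ.fromℚᵘ-cong (ℚᵘ.≃-sym (ℚ.toℚᵘ-homo-* (fromℚᵘ p) (fromℚᵘ q))) ⟩
  fromℚᵘ (toℚᵘ (fromℚᵘ p * fromℚᵘ q))
    ≡⟨ ℚ.fromℚᵘ-toℚᵘ (fromℚᵘ p * fromℚᵘ q) ⟩
  fromℚᵘ p * fromℚᵘ q ∎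

-- toℚ n is fromℚᵘ (ℕ→ℚᵘ n) by computation, which is what toℚ-homo-+ and toℚ-homo-* rely on.
ℕ→ℚᵘ : ℕ → ℚᵘ
ℕ→ℚᵘ n = mkℚᵘ (+ n) 0

ℕ→ℚᵘ-homo-+ : ∀ m n → ℕ→ℚᵘ (m ℕ.+ n) ℚᵘ.≃ ℕ→ℚᵘ m ℚᵘ.+ ℕ→ℚᵘ n
ℕ→ℚᵘ-homo-+ m n = *≡* (cong (ℤ._* + 1) (begin
  + (m ℕ.+ n)                  ≡⟨ ℤ.pos-+ m n ⟩
  + m ℤ.+ + n                  ≡⟨ cong₂ ℤ._+_ (ℤ.*-identityʳ (+ m)) (ℤ.*-identityʳ (+ n)) ⟨
  + m ℤ.* + 1 ℤ.+ + n ℤ.* + 1 ∎))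

ℕ→ℚᵘ-homo-* : ∀ m n → ℕ→ℚᵘ (m ℕ.* n) ℚᵘ.≃ ℕ→ℚᵘ m ℚᵘ.* ℕ→ℚᵘ n
ℕ→ℚᵘ-homo-* m n = *≡* (cong (ℤ._* + 1) (ℤ.pos-* m n))

toℚ-homo-+ : ∀ m n → toℚ (m ℕ.+ n) ≡ toℚ m + toℚ n
toℚ-homo-+ m n = trans (ℚ.fromℚᵘ-cong (ℕ→ℚᵘ-homo-+ m n)) (fromℚᵘ-homo-+ (ℕ→ℚᵘ m) (ℕ→ℚᵘ n))

toℚ-homo-* : ∀ m n → toℚ (m ℕ.* n) ≡ toℚ m * toℚ n
toℚ-homo-* m n = trans (ℚ.fromℚᵘ-cong (ℕ→ℚᵘ-homo-* m n)) (fromℚᵘ-homo-* (ℕ→ℚᵘ m) (ℕ→ℚᵘ n))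

1/n*n≡1 : ∀ n .{{_ : NonZero n}} → (+ 1 ℚ./ n) * toℚ n ≡ 1ℚ
1/n*n≡1 (suc k) = begin
  (+ 1 ℚ./ suc k) * toℚ (suc k)
    ≡⟨ cong₂ _*_ (ℚ.normalize-coprime (C.1-coprimeTo (suc k))) (ℚ.normalize-coprime (C.sym (C.1-coprimeTo (suc k)))) ⟩
  ℚ.1/ n * n
    ≡⟨ ℚ.*-inverseˡ n ⟩
  1ℚ ∎
  where
  n : ℚ
  n = ℚ.mkℚ (+ suc k) 0 (C.sym (C.1-coprimeTo (suc k)))

sum-∷ʳ : ∀ (xs : List ℚ) y → List.foldr _+_ 0ℚ (xs ∷ʳ y) ≡ List.foldr _+_ 0ℚ xs + y
sum-∷ʳ List.[]       y = trans (ℚ.+-identityʳ y) (sym (ℚ.+-identityˡ y))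
sum-∷ʳ (x List.∷ xs) y = trans (cong (ℚ._+_ x) (sum-∷ʳ xs y)) (sym (ℚ.+-assoc x _ y))

e-suc : ∀ r → e (suc r) ≡ e r + inv! (suc r)
e-suc r = begin
  e (suc r)
    ≡⟨ cong (λ ns → List.foldr _+_ 0ℚ (List.map inv! ns)) (sym (List.upTo-∷ʳ (suc r))) ⟩
  List.foldr _+_ 0ℚ (List.map inv! (List.upTo (suc r) ∷ʳ suc r))
    ≡⟨ cong (List.foldr _+_ 0ℚ) (List.map-++ inv! (List.upTo (suc r)) List.[ suc r ]) ⟩
  List.foldr _+_ 0ℚ (List.map inv! (List.upTo (suc r)) ∷ʳ inv! (suc r))
    ≡⟨ sum-∷ʳ (List.map inv! (List.upTo (suc r))) (inv! (suc r)) ⟩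
  e r + inv! (suc r) ∎

closedForm : ℕ → ℚ
closedForm r = (toℚ 3 - e r) * toℚ (r !) - toℚ 1

closedForm-suc : ∀ n → closedForm (2 ℕ.+ n) ≡ toℚ (2 ℕ.+ n) * closedForm (suc n) + toℚ n
closedForm-suc n = begin
  (toℚ 3 - e (2 ℕ.+ n)) * F′ - toℚ 1
    ≡⟨ cong (λ x → (toℚ 3 - x) * F′ - toℚ 1) (e-suc (suc n)) ⟩
  (toℚ 3 - (E + i)) * F′ - toℚ 1
    ≡⟨ solve 3 (λ E i F′ → (con (toℚ 3) :- (E :+ i)) :* F′ :- con (toℚ 1)
                          := (con (toℚ 3) :- E) :* F′ :- i :* F′ :- con (toℚ 1)) refl E i F′ ⟩
  (toℚ 3 - E) * F′ - i * F′ - toℚ 1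
    ≡⟨ cong (λ x → (toℚ 3 - E) * F′ - x - toℚ 1) (1/n*n≡1 ((2 ℕ.+ n) !) {{(2 ℕ.+ n) !≢0}}) ⟩
  (toℚ 3 - E) * F′ - 1ℚ - toℚ 1
    ≡⟨ cong (λ x → (toℚ 3 - E) * x - 1ℚ - toℚ 1) F′≡SF ⟩
  (toℚ 3 - E) * ((toℚ 2 + N) * F) - 1ℚ - toℚ 1
    ≡⟨ solve 3 (λ E N F → (con (toℚ 3) :- E) :* ((con (toℚ 2) :+ N) :* F) :- con 1ℚ :- con (toℚ 1)
                         := (con (toℚ 2) :+ N) :* ((con (toℚ 3) :- E) :* F :- con (toℚ 1)) :+ N) refl E N F ⟩
  (toℚ 2 + N) * closedForm (suc n) + N
    ≡⟨ cong (λ x → x * closedForm (suc n) + N) (sym (toℚ-homo-+ 2 n)) ⟩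
  toℚ (2 ℕ.+ n) * closedForm (suc n) + N ∎
  where
  open +-*-Solver
  E = e (suc n)
  i = inv! (2 ℕ.+ n)
  N = toℚ n
  F = toℚ (suc n !)
  F′ = toℚ ((2 ℕ.+ n) !)
  F′≡SF : F′ ≡ (toℚ 2 + N) * F
  F′≡SF = trans (toℚ-homo-* (2 ℕ.+ n) (suc n !)) (cong (_* F) (toℚ-homo-+ 2 n))

toℚ-w3≡closedForm : ∀ {w} → IsW w → ∀ n → toℚ (w3 w (2 ℕ.+ n)) ≡ closedForm (2 ℕ.+ n)
toℚ-w3≡closedForm W zero    = cong toℚ (w3-two W)
toℚ-w3≡closedForm {w} W (suc n) = begin
  toℚ (w3 w (3 ℕ.+ n))
    ≡⟨ cong toℚ (w3-suc W n) ⟩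
  toℚ ((3 ℕ.+ n) ℕ.* w3 w (2 ℕ.+ n) ℕ.+ suc n)
    ≡⟨ toℚ-homo-+ ((3 ℕ.+ n) ℕ.* w3 w (2 ℕ.+ n)) (suc n) ⟩
  toℚ ((3 ℕ.+ n) ℕ.* w3 w (2 ℕ.+ n)) + toℚ (suc n)
    ≡⟨ cong (_+ toℚ (suc n)) (toℚ-homo-* (3 ℕ.+ n) (w3 w (2 ℕ.+ n))) ⟩
  toℚ (3 ℕ.+ n) * toℚ (w3 w (2 ℕ.+ n)) + toℚ (suc n)
    ≡⟨ cong (λ x → toℚ (3 ℕ.+ n) * x + toℚ (suc n)) (toℚ-w3≡closedForm W n) ⟩
  toℚ (3 ℕ.+ n) * closedForm (2 ℕ.+ n) + toℚ (suc n)
    ≡⟨ sym (closedForm-suc (suc n)) ⟩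
  closedForm (3 ℕ.+ n) ∎

proposition5p1 : (w : Family) → IsW w → (r : ℕ) → 2 ≤ r →
    toℚ (w3 w r) ≡ (toℚ 3 - e r) * toℚ (r !) - toℚ 1
proposition5p1 w W (suc (suc n)) (s≤s (s≤s _)) = toℚ-w3≡closedForm W n
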